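{- Let $G=(X\cup Y,E)$ be a connected 3-regular bipartite graph with bipartition $X,Y$ and with $\operatorname{dal}(G)\le 2$. Then at least one of the 3-regular 3-uniform hypergraphs $\mathcal{H}_X$ or $\mathcal{H}_Y$ is 2-colorable, where $\mathcal{H}_X$ has vertex set $X$ and edge set $\{N_G(y): y\in Y\}$, and $\mathcal{H}_Y$ has vertex set $Y$ and edge set $\{N_G(x): x\in X\}$.
   Context: A hypergraph is 2-colorable if its vertices can be colored with 2 colors so that no hyperedge is monochromatic. $N_G(u)$ denotes the neighborhood of $u$ in $G$. For an edge-coloring $c:E(G)\to\{1,\dots,k\}$ (not necessarily proper), let $\bar c(v)=(a_1,\dots,a_k)$ where $a_i$ is the number of edges at $v$ of color $i$, and let $c^*(v)$ be $\bar c(v)$ sorted in nonincreasing order; $c$ is color-blind distinguishing if $c^*(u)\ne c^*(v)$ for every edge $uv$. $\operatorname{dal}(G)$ is the least $k$ for which such a coloring with colors $\{1,\dots,k\}$ exists ($\infty$ if none). -}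

module Defs where

open import Data.Nat using (ℕ; _≤_)
open import Data.Nat.Properties using (≤-decTotalOrder)
open import Data.Bool using (Bool; true; false; if_then_else_; _∧_)
open import Data.Fin using (Fin)
open import Data.Fin.Properties using () renaming (_≟_ to _≟ᶠ_)
open import Data.List using (List; map; reverse; allFin)
open import Data.Nat.ListAction using (sum)
open import Data.List.Sort.InsertionSort.Base ≤-decTotalOrder using (sort)
open import Data.Product using (Σ; ∃; _×_; _,_)
open import Data.Sum using (_⊎_; inj₁; inj₂)
open import Data.Empty using (⊥)
open import Relation.Nullary using (¬_; does)
open import Relation.Binary.PropositionalEquality using (_≡_; _≢_)
open import Relation.Binary.Construct.Closure.ReflexiveTransitive using (Star)

count : {n : ℕ} → (Fin n → Bool) → ℕ
count {n} p = sum (map (λ i → if p i then 1 else 0) (allFin n))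

-- A (simple) bipartite graph G = (X ∪ Y, E) with X = Fin a, Y = Fin b;
-- adj x y = true  iff  xy ∈ E.  Edges only go between X and Y.

record BipGraph : Set where
  field
    a b : ℕ
    adj : Fin a → Fin b → Bool

module _ (G : BipGraph) where
  open BipGraph G

  Vertex : Set
  Vertex = Fin a ⊎ Fin b

  Adj : Vertex → Vertex → Set
  Adj (inj₁ x) (inj₂ y) = adj x y ≡ true
  Adj (inj₂ y) (inj₁ x) = adj x y ≡ true
  Adj (inj₁ _) (inj₁ _) = ⊥
  Adj (inj₂ _) (inj₂ _) = ⊥

  degX : Fin a → ℕ
  degX x = count (λ y → adj x y)

  degY : Fin b → ℕ
  degY y = count (λ x → adj x y)

  Cubic : Set
  Cubic = (∀ x → degX x ≡ 3) × (∀ y → degY y ≡ 3)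

  Connected : Set
  Connected = ∀ u v → Star Adj u v

  -- an edge colouring with colours Fin k (the value on non-edges is irrelevant)
  EdgeColouring : ℕ → Set
  EdgeColouring k = Fin a → Fin b → Fin k

  cbarX : {k : ℕ} → EdgeColouring k → Fin a → List ℕ
  cbarX {k} c x = map (λ i → count (λ y → adj x y ∧ does (c x y ≟ᶠ i))) (allFin k)

  cbarY : {k : ℕ} → EdgeColouring k → Fin b → List ℕ
  cbarY {k} c y = map (λ i → count (λ x → adj x y ∧ does (c x y ≟ᶠ i))) (allFin k)

  sortDesc : List ℕ → List ℕ
  sortDesc l = reverse (sort l)

  cstarX : {k : ℕ} → EdgeColouring k → Fin a → List ℕ
  cstarX c x = sortDesc (cbarX c x)

  cstarY : {k : ℕ} → EdgeColouring k → Fin b → List ℕ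
  cstarY c y = sortDesc (cbarY c y)

  -- c*(u) ≠ c*(v) for every edge uv (every edge is xy with x ∈ X, y ∈ Y)
  ColourBlindDistinguishing : {k : ℕ} → EdgeColouring k → Set
  ColourBlindDistinguishing c =
    ∀ x y → adj x y ≡ true → cstarX c x ≢ cstarY c y

  DalAtMost : ℕ → Set
  DalAtMost K = Σ ℕ λ k → (1 ≤ k) × (k ≤ K) ×
                  Σ (EdgeColouring k) ColourBlindDistinguishing

record Hypergraph : Set where
  field
    n m : ℕ
    mem : Fin m → Fin n → Bool

module _ (H : Hypergraph) where
  open Hypergraph H

  Monochromatic : (Fin n → Bool) → Fin m → Set
  Monochromatic f e = ∃ λ col → ∀ v → mem e v ≡ true → f v ≡ col

  TwoColourable : Set
  TwoColourable = Σ (Fin n → Bool) λ f → ∀ e → ¬ Monochromatic f e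

HX : BipGraph → Hypergraph
HX G = record { n = BipGraph.a G ; m = BipGraph.b G ; mem = λ y x → BipGraph.adj G x y }

HY : BipGraph → Hypergraph
HY G = record { n = BipGraph.b G ; m = BipGraph.a G ; mem = λ x y → BipGraph.adj G x y }

-- With two colours every vertex of a cubic graph has colour profile {3,0} (all its edges
-- share a colour) or {2,1} (both colours occur).  A colour-blind distinguishing colouring
-- makes the two kinds alternate along edges, so in a connected bipartite graph one side,
-- say X, consists of single-coloured vertices and Y of two-coloured ones.  Colouring each
-- x by the colour of its edges then 2-colours H_X: every hyperedge N(y) meets both
-- colours.  A single colour distinguishes nothing, since then every c* equals (3).
module Submission where

open import Defs
open import Data.Nat.Properties using (+-commutativeSemigroup)
open import Algebra.Properties.CommutativeSemigroup +-commutativeSemigroup using (interchange)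
open import Data.Bool using (Bool; true; false; if_then_else_; _∧_; not)
open import Data.Bool.Properties using (∧-identityʳ; ¬-not; not-injective; not-involutive)
open import Data.Empty using (⊥-elim)
open import Data.Fin using (Fin; zero; suc)
open import Data.Fin.Properties using () renaming (_≟_ to _≟ᶠ_)
open import Data.List using (List; []; _∷_; tabulate; allFin)
open import Data.List.Properties using (map-tabulate; map-cong)
open import Data.Nat using (ℕ; zero; suc; _+_; s≤s)
open import Data.Nat.ListAction using (sum)
open import Data.Product using (Σ; ∃; _×_; _,_; proj₁; proj₂)
open import Data.Sum using (_⊎_; inj₁; inj₂)
open import Function using (_∘_; id)
open import Relation.Nullary using (¬_; Dec; yes; no; does; contradiction)
open import Relation.Binary.PropositionalEquality
open import Relation.Binary.Construct.Closure.ReflexiveTransitive using (Star; fold)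
open ≡-Reasoning

private variable n : ℕ

indicator : Bool → ℕ
indicator b = if b then 1 else 0

count-suc : (p : Fin (suc n) → Bool) → count p ≡ indicator (p zero) + count (p ∘ suc)
count-suc p = trans (count-tabulate p) (cong (indicator (p zero) +_) (sym (count-tabulate (p ∘ suc))))
  where
  count-tabulate : ∀ {n} (q : Fin n → Bool) → count q ≡ sum (tabulate (indicator ∘ q))
  count-tabulate q = cong sum (map-tabulate id (indicator ∘ q))

count-cong : {p q : Fin n → Bool} → (∀ i → p i ≡ q i) → count p ≡ count q
count-cong {n} p≗q = cong sum (map-cong (cong indicator ∘ p≗q) (allFin n))

count≡0⇒false : (p : Fin n → Bool) → count p ≡ 0 → ∀ i → p i ≡ false
count≡0⇒false {suc n} p c≡0 i with p zero in p₀ | count-suc p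
count≡0⇒false p c≡0 zero    | false | _ = p₀
count≡0⇒false p c≡0 (suc i) | false | c≡ = count≡0⇒false (p ∘ suc) (trans (sym c≡) c≡0) i
count≡0⇒false p c≡0 i       | true  | c≡ = contradiction (trans (sym c≡) c≡0) λ ()

count≢0⇒∃ : (p : Fin n → Bool) → count p ≢ 0 → ∃ λ i → p i ≡ true
count≢0⇒∃ {zero} p c≢0 = contradiction refl c≢0
count≢0⇒∃ {suc n} p c≢0 with p zero in p₀ | count-suc p
... | true  | _  = zero , p₀
... | false | c≡ = let i , pᵢ = count≢0⇒∃ (p ∘ suc) (c≢0 ∘ trans c≡) in suc i , pᵢ

indicator-∧-not : ∀ b c → indicator (b ∧ c) + indicator (b ∧ not c) ≡ indicator b
indicator-∧-not false _     = refl
indicator-∧-not true  false = refl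
indicator-∧-not true  true  = refl

count-∧-not : (p q : Fin n → Bool) →
  count (λ i → p i ∧ q i) + count (λ i → p i ∧ not (q i)) ≡ count p
count-∧-not {zero} p q = refl
count-∧-not {suc n} p q = begin
  count both + count only
    ≡⟨ cong₂ _+_ (count-suc both) (count-suc only) ⟩
  (indicator (both zero) + count (both ∘ suc)) + (indicator (only zero) + count (only ∘ suc))
    ≡⟨ interchange (indicator (both zero)) (count (both ∘ suc)) _ _ ⟩
  (indicator (both zero) + indicator (only zero)) + (count (both ∘ suc) + count (only ∘ suc))
    ≡⟨ cong₂ _+_ (indicator-∧-not (p zero) (q zero)) (count-∧-not (p ∘ suc) (q ∘ suc)) ⟩
  indicator (p zero) + count (p ∘ suc)
    ≡⟨ count-suc p ⟨
  count p ∎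
  where
  both only : Fin (suc n) → Bool
  both i = p i ∧ q i
  only i = p i ∧ not (q i)

colourDegree : {k : ℕ} → (Fin n → Bool) → (Fin n → Fin k) → Fin k → ℕ
colourDegree inc col i = count (λ j → inc j ∧ does (col j ≟ᶠ i))

colourDegree-monochrome : (inc : Fin n → Bool) (col : Fin n → Fin 1) →
  colourDegree inc col zero ≡ count inc
colourDegree-monochrome inc col =
  count-cong λ j → trans (cong (inc j ∧_) (is-zero (col j))) (∧-identityʳ (inc j))
  where
  is-zero : (i : Fin 1) → does (i ≟ᶠ zero) ≡ true
  is-zero zero = refl

∧-does≡true : ∀ {P : Set} b (P? : Dec P) → b ∧ does P? ≡ true → b ≡ true × P
∧-does≡true true (yes p) _ = refl , p

∧-does≡false : ∀ {P : Set} b (P? : Dec P) → b ∧ does P? ≡ false → b ≡ true → ¬ P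
∧-does≡false true (no ¬p) _ _ = ¬p
∧-does≡false false _ _ ()

≢zero⇒one : {i : Fin 2} → i ≢ zero → i ≡ suc zero
≢zero⇒one {zero}     i≢0 = contradiction refl i≢0
≢zero⇒one {suc zero} _   = refl

≢one⇒zero : {i : Fin 2} → i ≢ suc zero → i ≡ zero
≢one⇒zero {zero}     _   = refl
≢one⇒zero {suc zero} i≢1 = contradiction refl i≢1

SingleColoured : (Fin n → Bool) → (Fin n → Fin 2) → Set
SingleColoured inc col = Σ (Fin 2) λ i → ∀ j → inc j ≡ true → col j ≡ i

BothColoured : (Fin n → Bool) → (Fin n → Fin 2) → Set
BothColoured inc col = ∀ i → ∃ λ j → inc j ≡ true × col j ≡ i

hasZero : ℕ → ℕ → Bool
hasZero zero    _       = true
hasZero (suc _) zero    = true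
hasZero (suc _) (suc _) = false

cubicProfile : Bool → List ℕ
cubicProfile singleColoured = if singleColoured then 3 ∷ 0 ∷ [] else 2 ∷ 1 ∷ []

hasZero≡true : ∀ m n → hasZero m n ≡ true → m ≡ 0 ⊎ n ≡ 0
hasZero≡true zero    _    _ = inj₁ refl
hasZero≡true (suc _) zero _ = inj₂ refl

hasZero≡false : ∀ m n → hasZero m n ≡ false → m ≢ 0 × n ≢ 0
hasZero≡false (suc _) (suc _) _ = (λ ()) , (λ ())

module _ (inc : Fin n → Bool) (col : Fin n → Fin 2) where

  colourDegree-sum : colourDegree inc col zero + colourDegree inc col (suc zero) ≡ count inc
  colourDegree-sum =
    trans (cong (colourDegree inc col zero +_) (count-cong λ j → cong (inc j ∧_) (is-one (col j))))
          (count-∧-not inc (λ j → does (col j ≟ᶠ zero)))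
    where
    is-one : (i : Fin 2) → does (i ≟ᶠ suc zero) ≡ not (does (i ≟ᶠ zero))
    is-one zero       = refl
    is-one (suc zero) = refl

  colourDegree≡0⇒absent : ∀ i → colourDegree inc col i ≡ 0 → ∀ j → inc j ≡ true → col j ≢ i
  colourDegree≡0⇒absent i d≡0 j = ∧-does≡false (inc j) (col j ≟ᶠ i) (count≡0⇒false _ d≡0 j)

  colourDegree≢0⇒present : ∀ i → colourDegree inc col i ≢ 0 → ∃ λ j → inc j ≡ true × col j ≡ i
  colourDegree≢0⇒present i d≢0 =
    let j , inc∧≡ = count≢0⇒∃ _ d≢0 in j , ∧-does≡true (inc j) (col j ≟ᶠ i) inc∧≡

  hasZero⇒singleColoured :
    hasZero (colourDegree inc col zero) (colourDegree inc col (suc zero)) ≡ true →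
    SingleColoured inc col
  hasZero⇒singleColoured h with hasZero≡true _ _ h
  ... | inj₁ d₀≡0 = suc zero , λ j → ≢zero⇒one ∘ colourDegree≡0⇒absent zero d₀≡0 j
  ... | inj₂ d₁≡0 = zero , λ j → ≢one⇒zero ∘ colourDegree≡0⇒absent (suc zero) d₁≡0 j

  ¬hasZero⇒bothColoured :
    hasZero (colourDegree inc col zero) (colourDegree inc col (suc zero)) ≡ false →
    BothColoured inc col
  ¬hasZero⇒bothColoured h zero       = colourDegree≢0⇒present zero (proj₁ (hasZero≡false _ _ h))
  ¬hasZero⇒bothColoured h (suc zero) = colourDegree≢0⇒present (suc zero) (proj₂ (hasZero≡false _ _ h))

module _ (H : Hypergraph) where
  open Hypergraph H renaming (n to nᵥ; m to nₑ)

  incidenceColouring⇒twoColourable : (col : Fin nₑ → Fin nᵥ → Fin 2) →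
    (∀ v → SingleColoured (λ e → mem e v) (λ e → col e v)) →
    (∀ e → BothColoured (mem e) (col e)) →
    TwoColourable H
  incidenceColouring⇒twoColourable col single both = f , not-monochromatic
    where
    f : Fin nᵥ → Bool
    f v = does (proj₁ (single v) ≟ᶠ zero)

    f-at : ∀ e v → mem e v ≡ true → f v ≡ does (col e v ≟ᶠ zero)
    f-at e v e∋v = cong (does ∘ (_≟ᶠ zero)) (sym (proj₂ (single v) e e∋v))

    not-monochromatic : ∀ e → ¬ Monochromatic H f e
    not-monochromatic e (b , mono) with both e zero | both e (suc zero)
    ... | v₀ , e∋v₀ , col≡0 | v₁ , e∋v₁ , col≡1 = contradiction
      (begin
        true                     ≡⟨ cong (does ∘ (_≟ᶠ zero)) col≡0 ⟨
        does (col e v₀ ≟ᶠ zero)  ≡⟨ f-at e v₀ e∋v₀ ⟨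
        f v₀                     ≡⟨ mono v₀ e∋v₀ ⟩
        b                        ≡⟨ mono v₁ e∋v₁ ⟨
        f v₁                     ≡⟨ f-at e v₁ e∋v₁ ⟩
        does (col e v₁ ≟ᶠ zero)  ≡⟨ cong (does ∘ (_≟ᶠ zero)) col≡1 ⟩
        false                    ∎)
      λ ()

module _ (G : BipGraph) where
  open BipGraph G

  sortDesc-pair : ∀ n₀ n₁ → n₀ + n₁ ≡ 3 →
    sortDesc G (n₀ ∷ n₁ ∷ []) ≡ cubicProfile (hasZero n₀ n₁)
  sortDesc-pair 0 .3 refl = refl
  sortDesc-pair 1 .2 refl = refl
  sortDesc-pair 2 .1 refl = refl
  sortDesc-pair 3 .0 refl = refl

  alternating⇒sidesConstant : Connected G → (ℓX : Fin a → Bool) (ℓY : Fin b → Bool) →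
    (∀ x y → adj x y ≡ true → ℓX x ≢ ℓY y) → (x₀ : Fin a) →
    (∀ x → ℓX x ≡ ℓX x₀) × (∀ y → ℓY y ≡ not (ℓX x₀))
  alternating⇒sidesConstant connected ℓX ℓY alternating x₀ =
    (λ x → along (connected (inj₁ x) (inj₁ x₀))) ,
    (λ y → not-injective (trans (along (connected (inj₂ y) (inj₁ x₀))) (sym (not-involutive (ℓX x₀)))))
    where
    ℓ : Vertex G → Bool
    ℓ (inj₁ x) = ℓX x
    ℓ (inj₂ y) = not (ℓY y)

    step : ∀ {u v} → Adj G u v → ℓ u ≡ ℓ v
    step {inj₁ x} {inj₂ y} xy = ¬-not (alternating x y xy)
    step {inj₂ y} {inj₁ x} xy = sym (¬-not (alternating x y xy))

    along : ∀ {u v} → Star (Adj G) u v → ℓ u ≡ ℓ v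
    along = fold (λ u v → ℓ u ≡ ℓ v) (trans ∘ step) refl

  neighbour : Cubic G → ∀ x → ∃ λ y → adj x y ≡ true
  neighbour cubic x = count≢0⇒∃ (adj x) λ deg≡0 → contradiction (trans (sym (proj₁ cubic x)) deg≡0) λ ()

  oneColour¬distinguishing : Cubic G → Fin a → (c : EdgeColouring G 1) →
    ¬ ColourBlindDistinguishing G c
  oneColour¬distinguishing cubic x₀ c distinguishing =
    let y , x₀y = neighbour cubic x₀ in
    distinguishing x₀ y x₀y (cong (sortDesc G) (trans (cbarX≡3 x₀) (sym (cbarY≡3 y))))
    where
    cbarX≡3 : ∀ x → cbarX G c x ≡ 3 ∷ []
    cbarX≡3 x = cong (_∷ []) (trans (colourDegree-monochrome (adj x) (c x)) (proj₁ cubic x))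

    cbarY≡3 : ∀ y → cbarY G c y ≡ 3 ∷ []
    cbarY≡3 y = cong (_∷ []) (trans (colourDegree-monochrome (λ x → adj x y) (λ x → c x y)) (proj₂ cubic y))

  module _ (connected : Connected G) (cubic : Cubic G)
           (c : EdgeColouring G 2) (distinguishing : ColourBlindDistinguishing G c) where

    singleColouredX : Fin a → Bool
    singleColouredX x = hasZero (colourDegree (adj x) (c x) zero) (colourDegree (adj x) (c x) (suc zero))

    singleColouredY : Fin b → Bool
    singleColouredY y = hasZero (colourDegree (λ x → adj x y) (λ x → c x y) zero)
                                (colourDegree (λ x → adj x y) (λ x → c x y) (suc zero))

    singleColoured-alternates : ∀ x y → adj x y ≡ true → singleColouredX x ≢ singleColouredY y
    singleColoured-alternates x y xy same = distinguishing x y xy (begin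
      cstarX G c x                     ≡⟨ sortDesc-pair _ _ (trans (colourDegree-sum (adj x) (c x)) (proj₁ cubic x)) ⟩
      cubicProfile (singleColouredX x) ≡⟨ cong cubicProfile same ⟩
      cubicProfile (singleColouredY y) ≡⟨ sortDesc-pair _ _ (trans (colourDegree-sum (λ x → adj x y) (λ x → c x y)) (proj₂ cubic y)) ⟨
      cstarY G c y                     ∎)

    twoColours⇒twoColourable : Fin a → TwoColourable (HX G) ⊎ TwoColourable (HY G)
    twoColours⇒twoColourable x₀
      with singleColouredX x₀
         | alternating⇒sidesConstant connected singleColouredX singleColouredY singleColoured-alternates x₀
    ... | true  | X-single , Y-both = inj₁ (incidenceColouring⇒twoColourable (HX G) (λ y x → c x y)
          (λ x → hasZero⇒singleColoured _ _ (X-single x)) (λ y → ¬hasZero⇒bothColoured _ _ (Y-both y)))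
    ... | false | X-both , Y-single = inj₂ (incidenceColouring⇒twoColourable (HY G) c
          (λ y → hasZero⇒singleColoured _ _ (Y-single y)) (λ x → ¬hasZero⇒bothColoured _ _ (X-both x)))

proposition7 : (G : BipGraph) → Connected G → Cubic G → DalAtMost G 2 →
    TwoColourable (HX G) ⊎ TwoColourable (HY G)
-- Without X-vertices every Y-vertex would have degree 0, so the graph is empty.
proposition7 record { a = zero } _ cubic _ = inj₁ ((λ ()) , λ y → contradiction (proj₂ cubic y) λ ())
proposition7 G@record { a = suc _ } _ cubic (1 , _ , _ , c , distinguishing) =
  ⊥-elim (oneColour¬distinguishing G cubic zero c distinguishing)
proposition7 G@record { a = suc _ } connected cubic (2 , _ , _ , c , distinguishing) =
  twoColours⇒twoColourable G connected cubic c distinguishing zero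
proposition7 _ _ _ (0 , () , _)
proposition7 _ _ _ (suc (suc (suc _)) , _ , s≤s (s≤s ()) , _)
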